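{- Let $C$ be an identifying code in $C_n(1,3)$ such that there is no vertex $u\in\mathbb{Z}_n$ for which the vertices $u,u+1,\dots,u+8$ form a pattern $P$ or a pattern $P'$. Then: (i) if $n = 11q_1+2$ with $q_1 \geq 5$, then $|C| \geq 4q_1+2 = \lceil 4n/11\rceil + 1$; (ii) if $n = 11q_2+5$ with $q_2 \geq 3$, then $|C| \geq 4q_2+3 = \lceil 4n/11\rceil + 1$; (iii) if $n = 11q_3+8$ with $q_3 \geq 1$, then $|C| \geq 4q_3+4 = \lceil 4n/11\rceil + 1$.
   Context: For a positive integer $n$, the circulant graph $C_n(1,3)$ has vertex set $\mathbb{Z}_n$, and $u$ is adjacent to $u\pm1$ and $u\pm 3$ (modulo $n$); $N[u]=\{u,u\pm1,u\pm3\}$. For a code (nonempty subset) $C\subseteq\mathbb{Z}_n$, $I(C;u)=N[u]\cap C$. $C$ is identifying if all $I(C;u)$ are nonempty and pairwise distinct for distinct vertices. For a vertex $u$, the consecutive vertices $u,u+1,\dots,u+8$ form a pattern $P$ if $\{u+2,u+3\}\subseteq C$ and $\{u,u+1,u+4,u+5,u+6,u+7,u+8\}\cap C=\emptyset$; they form a pattern $P'$ if $\{u+5,u+6\}\subseteq C$ and $\{u,u+1,u+2,u+3,u+4,u+7,u+8\}\cap C=\emptyset$. -}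

module Defs where

open import Data.Nat using (ℕ; suc; _+_; _*_; _∸_; NonZero)
open import Data.Nat.DivMod using (_%_; _mod_)
open import Data.Fin using (Fin; toℕ)
open import Data.Fin.Subset using (Subset; _∈_; _∉_; _∩_; Nonempty)
open import Data.Vec using (tabulate)
open import Data.Bool using (Bool; true; false; _∨_)
open import Data.Product using (_×_; ∃)
open import Data.Sum using (_⊎_)
open import Relation.Binary.PropositionalEquality using (_≡_; _≢_)
open import Relation.Nullary using (¬_; does)
open import Data.Fin.Properties using () renaming (_≟_ to _≟ᶠ_)

_⊕_ : ∀ {n} .{{_ : NonZero n}} → Fin n → ℕ → Fin n
_⊕_ {n} u k = (toℕ u + k) mod n

_⊖_ : ∀ {n} .{{_ : NonZero n}} → Fin n → ℕ → Fin n
_⊖_ {n} u k = (toℕ u + (n ∸ (k % n))) mod n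

N[_] : ∀ {n} .{{_ : NonZero n}} → Fin n → Subset n
N[_] u = tabulate λ v →
  does (v ≟ᶠ u) ∨ does (v ≟ᶠ (u ⊕ 1)) ∨ does (v ≟ᶠ (u ⊖ 1))
    ∨ does (v ≟ᶠ (u ⊕ 3)) ∨ does (v ≟ᶠ (u ⊖ 3))

I : ∀ {n} .{{_ : NonZero n}} → Subset n → Fin n → Subset n
I C u = N[ u ] ∩ C

IsIdentifying : ∀ {n} .{{_ : NonZero n}} → Subset n → Set
IsIdentifying {n} C =
  Nonempty C
  × (∀ (u : Fin n) → Nonempty (I C u))
  × (∀ (u v : Fin n) → u ≢ v → I C u ≢ I C v)

PatternP : ∀ {n} .{{_ : NonZero n}} → Subset n → Fin n → Set
PatternP C u =
  (u ⊕ 2) ∈ C × (u ⊕ 3) ∈ C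
  × (u ⊕ 0) ∉ C × (u ⊕ 1) ∉ C × (u ⊕ 4) ∉ C × (u ⊕ 5) ∉ C
  × (u ⊕ 6) ∉ C × (u ⊕ 7) ∉ C × (u ⊕ 8) ∉ C

PatternP' : ∀ {n} .{{_ : NonZero n}} → Subset n → Fin n → Set
PatternP' C u =
  (u ⊕ 5) ∈ C × (u ⊕ 6) ∈ C
  × (u ⊕ 0) ∉ C × (u ⊕ 1) ∉ C × (u ⊕ 2) ∉ C × (u ⊕ 3) ∉ C
  × (u ⊕ 4) ∉ C × (u ⊕ 7) ∉ C × (u ⊕ 8) ∉ C

-- Read the code C as a cyclic bit sequence c_0 … c_{n-1}. Around every vertex u the 13 bits
-- c_u … c_{u+12} form a window, and the hypotheses (C identifying, no pattern P or P' anywhere)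
-- force every window to be *admissible*: I(C; u+3) is nonempty, differs from I(C; u+3+d) for
-- d = 1 … 6, and the window does not start with P or P'. A computed potential Ψ on 12-bit states
-- satisfies 10 + Ψ(c_{u+1} … c_{u+12}) ≤ 27·c_{u+12} + Ψ(c_u … c_{u+11}) for every admissible window;
-- this is verified by exhaustive evaluation over all 2^13 windows. Summing around the cycle the
-- potential telescopes away and gives the density bound 10·n ≤ 27·|C|, from which the three
-- claimed lower bounds follow by arithmetic.
module Submission where

open import Defs
open import Data.Nat using (ℕ; zero; suc; _+_; _*_; _∸_; _≤_; _≥_; _<_; z≤n; s≤s; z<s; s<s; _<?_; _≤?_; _≤ᵇ_; _%_; NonZero)
open import Data.Nat.Properties
  using ( ≤-refl; ≤-trans; <-irrefl; ≤-pred; <⇒≤; ≮⇒≥; m≤m+n; m<m+n; m∸n≤m; ≤ᵇ⇒≤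
        ; +-assoc; +-comm; +-suc; +-identityʳ; *-comm; *-zeroʳ; *-distribˡ-+
        ; +-mono-≤; +-monoˡ-≤; +-monoʳ-≤; +-mono-<; *-monoʳ-≤; ∸-monoˡ-<
        ; +-cancelˡ-≡; +-cancelʳ-≡; +-cancelˡ-≤; +-cancelʳ-≤
        ; m∸n+n≡m; m+[n∸m]≡n; m+n∸n≡m; module ≤-Reasoning )
open import Data.Nat.DivMod
  using (_mod_; %-distribˡ-+; m%n%n≡m%n; [m+n]%n≡m%n; m<n⇒m%n≡m; m%n<n; m≤n⇒[n∸m]%m≡n%m)
open import Data.Nat.Tactic.RingSolver using (solve-∀)
open import Data.Bool using (Bool; true; false; T; T?; _∧_; _∨_)
import Data.Bool as Bool
open import Data.Bool.Properties using (T-≡; T-∧; ∨-identityʳ)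
open import Data.Bool.ListAction using (any)
open import Data.List using (List; []; _∷_; map; upTo)
open import Data.List.Relation.Unary.All as All using (All; []; _∷_)
open import Data.List.Relation.Unary.All.Properties using (applyUpTo⁺₁)
open import Data.List.Relation.Unary.Any as Any using (Any)
open import Data.List.Relation.Unary.Any.Properties using (any⁺; any⁻; map⁺; map⁻)
open import Data.List.Membership.Propositional using (find; lose) renaming (_∈_ to _∈ˡ_)
open import Data.List.Membership.DecPropositional Data.Nat._≟_ using (_∈?_)
open import Data.Fin using (Fin; toℕ)
open import Data.Fin.Properties using (toℕ-injective; toℕ-fromℕ<; toℕ<n) renaming (_≟_ to _≟ᶠ_)
open import Data.Fin.Subset using (Subset; ∣_∣; _∈_; _∉_; _⊆_; Nonempty)
open import Data.Fin.Subset.Properties using (⊆-antisym; x∈p∩q⁺; x∈p∩q⁻)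
open import Data.Vec using (Vec; []; _∷_; lookup; tabulate; init; tail; last)
open import Data.Vec.Properties using (lookup∘tabulate; []=⇒lookup; lookup⇒[]=; tabulate∘lookup; tabulate-cong)
open import Data.Product using (∃; _×_; _,_; proj₁; proj₂)
open import Data.Empty using (⊥-elim)
open import Function using (_∘_; id; Equivalence)
open import Relation.Binary.PropositionalEquality
  using (_≡_; _≢_; refl; sym; trans; cong; cong₂; subst; module ≡-Reasoning)
open import Relation.Nullary using (¬_; Dec; does; yes; no; ¬?)
open import Relation.Nullary.Decidable using (_×-dec_; _→-dec_; isYes; toWitness)

Σ< : ℕ → (ℕ → ℕ) → ℕ
Σ< zero    f = 0
Σ< (suc m) f = f 0 + Σ< m (f ∘ suc)

Σ<-cong : ∀ m {f g : ℕ → ℕ} → (∀ k → k < m → f k ≡ g k) → Σ< m f ≡ Σ< m g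
Σ<-cong zero    f≡g = refl
Σ<-cong (suc m) f≡g = cong₂ _+_ (f≡g 0 (s≤s z≤n)) (Σ<-cong m (λ k k<m → f≡g (suc k) (s≤s k<m)))

Σ<-mono-≤ : ∀ m {f g : ℕ → ℕ} → (∀ k → f k ≤ g k) → Σ< m f ≤ Σ< m g
Σ<-mono-≤ zero    f≤g = z≤n
Σ<-mono-≤ (suc m) f≤g = +-mono-≤ (f≤g 0) (Σ<-mono-≤ m (f≤g ∘ suc))

Σ<-+ : ∀ m (f g : ℕ → ℕ) → Σ< m (λ k → f k + g k) ≡ Σ< m f + Σ< m g
Σ<-+ zero    f g = refl
Σ<-+ (suc m) f g = begin
  f 0 + g 0 + Σ< m (λ k → f (suc k) + g (suc k))  ≡⟨ cong (f 0 + g 0 +_) (Σ<-+ m (f ∘ suc) (g ∘ suc)) ⟩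
  f 0 + g 0 + (Σ< m (f ∘ suc) + Σ< m (g ∘ suc))  ≡⟨ interchange (f 0) (g 0) _ _ ⟩
  f 0 + Σ< m (f ∘ suc) + (g 0 + Σ< m (g ∘ suc))  ∎
  where
    open ≡-Reasoning
    interchange : ∀ a b c d → a + b + (c + d) ≡ a + c + (b + d)
    interchange = solve-∀

Σ<-const : ∀ m c → Σ< m (λ _ → c) ≡ m * c
Σ<-const zero    c = refl
Σ<-const (suc m) c = cong (c +_) (Σ<-const m c)

Σ<-*ˡ : ∀ m c (f : ℕ → ℕ) → Σ< m (λ k → c * f k) ≡ c * Σ< m f
Σ<-*ˡ zero    c f = sym (*-zeroʳ c)
Σ<-*ˡ (suc m) c f = trans (cong (c * f 0 +_) (Σ<-*ˡ m c (f ∘ suc))) (sym (*-distribˡ-+ c (f 0) _))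

Σ<-rotate : ∀ m (f : ℕ → ℕ) → Σ< m (f ∘ suc) + f 0 ≡ Σ< m f + f m
Σ<-rotate zero    f = refl
Σ<-rotate (suc m) f = begin
  f 1 + Σ< m (f ∘ suc ∘ suc) + f 0    ≡⟨ rearrange (f 1) _ (f 0) ⟩
  f 0 + (Σ< m (f ∘ suc ∘ suc) + f 1)  ≡⟨ cong (f 0 +_) (Σ<-rotate m (f ∘ suc)) ⟩
  f 0 + (Σ< m (f ∘ suc) + f (suc m))  ≡⟨ +-assoc (f 0) _ _ ⟨
  f 0 + Σ< m (f ∘ suc) + f (suc m)    ∎
  where
    open ≡-Reasoning
    rearrange : ∀ a s c → a + s + c ≡ c + (s + a)
    rearrange = solve-∀

Periodic : ℕ → (ℕ → ℕ) → Set
Periodic n f = ∀ k → f (n + k) ≡ f k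

Σ<-shift : ∀ n (f : ℕ → ℕ) → Periodic n f → ∀ j → Σ< n (λ k → f (k + j)) ≡ Σ< n f
Σ<-shift n f per zero    = Σ<-cong n (λ k _ → cong f (+-identityʳ k))
Σ<-shift n f per (suc j) = begin
  Σ< n (λ k → f (k + suc j))  ≡⟨ Σ<-cong n (λ k _ → cong f (+-suc k j)) ⟩
  Σ< n (g ∘ suc)              ≡⟨ +-cancelʳ-≡ (g 0) _ _ (trans (Σ<-rotate n g) (cong (Σ< n g +_) g-periodic)) ⟩
  Σ< n g                      ≡⟨ Σ<-shift n f per j ⟩
  Σ< n f                      ∎
  where
    open ≡-Reasoning
    g : ℕ → ℕ
    g k = f (k + j)
    g-periodic : g n ≡ g 0
    g-periodic = per j

-- Discharging around a cycle: if a periodic potential Ψ satisfies a + Ψ (k+1) ≤ b·x k + Ψ k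
-- at every step, then summing over one period the potential cancels and n·a ≤ b·Σ x.
cyclic-discharging : ∀ n (x Ψ : ℕ → ℕ) a b → Periodic n Ψ
  → (∀ k → a + Ψ (suc k) ≤ b * x k + Ψ k) → n * a ≤ b * Σ< n x
cyclic-discharging n x Ψ a b per step = +-cancelʳ-≤ (Σ< n Ψ) _ _ (begin
  n * a + Σ< n Ψ                           ≡⟨ cong₂ _+_ (Σ<-const n a) (Σ<-shift n Ψ per 1) ⟨
  Σ< n (λ _ → a) + Σ< n (λ k → Ψ (k + 1))  ≡⟨ Σ<-+ n (λ _ → a) (λ k → Ψ (k + 1)) ⟨
  Σ< n (λ k → a + Ψ (k + 1))               ≡⟨ Σ<-cong n (λ k _ → cong (λ z → a + Ψ z) (+-comm k 1)) ⟩
  Σ< n (λ k → a + Ψ (suc k))               ≤⟨ Σ<-mono-≤ n step ⟩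
  Σ< n (λ k → b * x k + Ψ k)               ≡⟨ Σ<-+ n (λ k → b * x k) Ψ ⟩
  Σ< n (λ k → b * x k) + Σ< n Ψ            ≡⟨ cong (_+ Σ< n Ψ) (Σ<-*ˡ n b x) ⟩
  b * Σ< n x + Σ< n Ψ                      ∎)
  where open ≤-Reasoning

-- A word is a bit sequence read along the cycle from some vertex: bit p tells whether the
-- vertex at offset p is a codeword. Only offsets 0, …, 12 (a window) are ever inspected.
Word : Set
Word = ℕ → Bool

-- The word spelled by a bit vector (bits beyond its length read as false).
wordOf : ∀ {m} → Vec Bool m → Word
wordOf []       _       = false
wordOf (b ∷ bs) zero    = b
wordOf (b ∷ bs) (suc p) = wordOf bs p

wordOf-tabulate : ∀ m (w : Word) {p} → p < m → wordOf (tabulate {n = m} (w ∘ toℕ)) p ≡ w p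
wordOf-tabulate (suc m) w {zero}  _         = refl
wordOf-tabulate (suc m) w {suc p} (s<s p<m) = wordOf-tabulate m (w ∘ suc) p<m

indicator : Bool → ℕ
indicator true  = 1
indicator false = 0

∣∷∣ : ∀ {m} b (v : Subset m) → ∣ b ∷ v ∣ ≡ indicator b + ∣ v ∣
∣∷∣ true  v = refl
∣∷∣ false v = refl

∣tabulate∣ : ∀ m (w : Word) → ∣ tabulate {n = m} (w ∘ toℕ) ∣ ≡ Σ< m (indicator ∘ w)
∣tabulate∣ zero    w = refl
∣tabulate∣ (suc m) w = trans (∣∷∣ {m} (w 0) (tabulate ((w ∘ suc) ∘ toℕ))) (cong (indicator (w 0) +_) (∣tabulate∣ m (w ∘ suc)))

-- The offsets of the closed neighbourhood of offset a, in the order a, a+1, a-1, a+3, a-3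
-- (faithful for a ≥ 3).
offsets : ℕ → List ℕ
offsets a = a ∷ a + 1 ∷ a ∸ 1 ∷ a + 3 ∷ a ∸ 3 ∷ []

offsets-in-window : ∀ {a} → a ≤ 9 → All (_< 13) (offsets a)
offsets-in-window {a} a≤9 =
  s≤s (≤-trans (m≤m+n a 3) a+3≤12) ∷ s≤s (≤-trans (+-monoʳ-≤ a (s≤s z≤n)) a+3≤12)
  ∷ s≤s (≤-trans (m∸n≤m a 1) (≤-trans (m≤m+n a 3) a+3≤12)) ∷ s≤s a+3≤12
  ∷ s≤s (≤-trans (m∸n≤m a 3) (≤-trans (m≤m+n a 3) a+3≤12)) ∷ []
  where
    a+3≤12 : a + 3 ≤ 12
    a+3≤12 = +-monoˡ-≤ 3 a≤9

-- Some vertex of N[3] is a codeword: I(C; u+3) is nonempty.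
Dominated : Word → Set
Dominated w = Any (T ∘ w) (offsets 3)

-- Every codeword of N[a] lies in N[a']: I(C; u+a) ⊆ I(C; u+a').
Covers : ℕ → ℕ → Word → Set
Covers a a' w = All (λ p → T (w p) → p ∈ˡ offsets a') (offsets a)

-- I(C; u+a) = I(C; u+a') as far as the window shows.
Twins : ℕ → ℕ → Word → Set
Twins a a' w = Covers a a' w × Covers a' a w

Matches : List (ℕ × Bool) → Word → Set
Matches pat w = All (λ { (p , b) → w p ≡ b }) pat

-- The patterns P and P', listed in the order of the definitions PatternP and PatternP'.
patternP patternP' : List (ℕ × Bool)
patternP = (2 , true) ∷ (3 , true) ∷ (0 , false) ∷ (1 , false) ∷ (4 , false)
  ∷ (5 , false) ∷ (6 , false) ∷ (7 , false) ∷ (8 , false) ∷ []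
patternP' = (5 , true) ∷ (6 , true) ∷ (0 , false) ∷ (1 , false) ∷ (2 , false)
  ∷ (3 , false) ∷ (4 , false) ∷ (7 , false) ∷ (8 , false) ∷ []

-- The local conditions an identifying, pattern-free code imposes on each window:
-- I(C; u+3) ≠ ∅, I(C; u+3) ≠ I(C; u+4+i) for i < 6, and the window starts with neither P nor P'.
Admissible : Word → Set
Admissible w = Dominated w × All (λ i → ¬ Twins 3 (4 + i) w) (upTo 6)
  × ¬ Matches patternP w × ¬ Matches patternP' w

covers? : ∀ a a' w → Dec (Covers a a' w)
covers? a a' w = All.all? (λ p → T? (w p) →-dec p ∈? offsets a') (offsets a)

matches? : ∀ pat w → Dec (Matches pat w)
matches? pat w = All.all? (λ { (p , b) → w p Bool.≟ b }) pat

admissible? : ∀ w → Dec (Admissible w)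
admissible? w = Any.any? (T? ∘ w) (offsets 3)
  ×-dec All.all? (λ i → ¬? (covers? 3 (4 + i) w ×-dec covers? (4 + i) 3 w)) _
  ×-dec ¬? (matches? patternP w) ×-dec ¬? (matches? patternP' w)

-- Binary decision trees with natural-number leaves: a compact table of a function of a bit
-- vector (the left subtree is taken on true). Leaves above full depth ignore the remaining bits.
data Tree : Set where
  leaf : ℕ → Tree
  node : Tree → Tree → Tree

evalTree : ∀ {m} → Tree → Vec Bool m → ℕ
evalTree (leaf x)   _            = x
evalTree (node t f) []           = 0
evalTree (node t f) (true ∷ bs)  = evalTree t bs
evalTree (node t f) (false ∷ bs) = evalTree f bs

-- The potential Ψ on 12-bit states, as a shared decision tree with root ψ466. It was computed as
-- 120 plus the least weight of a walk through admissible windows ending in the given state, where a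
-- step that appends bit c weighs 27·c − 10 (Bellman–Ford); `certificate` below checks it.
ψ0 ψ1 ψ2 ψ3 ψ4 ψ5 ψ6 ψ7 ψ8 ψ9 ψ10 ψ11 ψ12 ψ13 ψ14 ψ15 ψ16 ψ17 ψ18 ψ19 ψ20 ψ21 ψ22 ψ23 ψ24 ψ25
  ψ26 ψ27 ψ28 ψ29 ψ30 ψ31 ψ32 ψ33 ψ34 ψ35 ψ36 ψ37 ψ38 ψ39 ψ40 ψ41 ψ42 ψ43 ψ44 ψ45 ψ46 ψ47 ψ48 ψ49
  ψ50 ψ51 ψ52 ψ53 ψ54 ψ55 ψ56 ψ57 ψ58 ψ59 ψ60 ψ61 ψ62 ψ63 ψ64 ψ65 ψ66 ψ67 ψ68 ψ69 ψ70 ψ71 ψ72 ψ73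
  ψ74 ψ75 ψ76 ψ77 ψ78 ψ79 ψ80 ψ81 ψ82 ψ83 ψ84 ψ85 ψ86 ψ87 ψ88 ψ89 ψ90 ψ91 ψ92 ψ93 ψ94 ψ95 ψ96 ψ97
  ψ98 ψ99 ψ100 ψ101 ψ102 ψ103 ψ104 ψ105 ψ106 ψ107 ψ108 ψ109 ψ110 ψ111 ψ112 ψ113 ψ114 ψ115 ψ116
  ψ117 ψ118 ψ119 ψ120 ψ121 ψ122 ψ123 ψ124 ψ125 ψ126 ψ127 ψ128 ψ129 ψ130 ψ131 ψ132 ψ133 ψ134 ψ135
  ψ136 ψ137 ψ138 ψ139 ψ140 ψ141 ψ142 ψ143 ψ144 ψ145 ψ146 ψ147 ψ148 ψ149 ψ150 ψ151 ψ152 ψ153 ψ154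
  ψ155 ψ156 ψ157 ψ158 ψ159 ψ160 ψ161 ψ162 ψ163 ψ164 ψ165 ψ166 ψ167 ψ168 ψ169 ψ170 ψ171 ψ172 ψ173
  ψ174 ψ175 ψ176 ψ177 ψ178 ψ179 ψ180 ψ181 ψ182 ψ183 ψ184 ψ185 ψ186 ψ187 ψ188 ψ189 ψ190 ψ191 ψ192
  ψ193 ψ194 ψ195 ψ196 ψ197 ψ198 ψ199 ψ200 ψ201 ψ202 ψ203 ψ204 ψ205 ψ206 ψ207 ψ208 ψ209 ψ210 ψ211
  ψ212 ψ213 ψ214 ψ215 ψ216 ψ217 ψ218 ψ219 ψ220 ψ221 ψ222 ψ223 ψ224 ψ225 ψ226 ψ227 ψ228 ψ229 ψ230
  ψ231 ψ232 ψ233 ψ234 ψ235 ψ236 ψ237 ψ238 ψ239 ψ240 ψ241 ψ242 ψ243 ψ244 ψ245 ψ246 ψ247 ψ248 ψ249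
  ψ250 ψ251 ψ252 ψ253 ψ254 ψ255 ψ256 ψ257 ψ258 ψ259 ψ260 ψ261 ψ262 ψ263 ψ264 ψ265 ψ266 ψ267 ψ268
  ψ269 ψ270 ψ271 ψ272 ψ273 ψ274 ψ275 ψ276 ψ277 ψ278 ψ279 ψ280 ψ281 ψ282 ψ283 ψ284 ψ285 ψ286 ψ287
  ψ288 ψ289 ψ290 ψ291 ψ292 ψ293 ψ294 ψ295 ψ296 ψ297 ψ298 ψ299 ψ300 ψ301 ψ302 ψ303 ψ304 ψ305 ψ306
  ψ307 ψ308 ψ309 ψ310 ψ311 ψ312 ψ313 ψ314 ψ315 ψ316 ψ317 ψ318 ψ319 ψ320 ψ321 ψ322 ψ323 ψ324 ψ325
  ψ326 ψ327 ψ328 ψ329 ψ330 ψ331 ψ332 ψ333 ψ334 ψ335 ψ336 ψ337 ψ338 ψ339 ψ340 ψ341 ψ342 ψ343 ψ344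
  ψ345 ψ346 ψ347 ψ348 ψ349 ψ350 ψ351 ψ352 ψ353 ψ354 ψ355 ψ356 ψ357 ψ358 ψ359 ψ360 ψ361 ψ362 ψ363
  ψ364 ψ365 ψ366 ψ367 ψ368 ψ369 ψ370 ψ371 ψ372 ψ373 ψ374 ψ375 ψ376 ψ377 ψ378 ψ379 ψ380 ψ381 ψ382
  ψ383 ψ384 ψ385 ψ386 ψ387 ψ388 ψ389 ψ390 ψ391 ψ392 ψ393 ψ394 ψ395 ψ396 ψ397 ψ398 ψ399 ψ400 ψ401
  ψ402 ψ403 ψ404 ψ405 ψ406 ψ407 ψ408 ψ409 ψ410 ψ411 ψ412 ψ413 ψ414 ψ415 ψ416 ψ417 ψ418 ψ419 ψ420
  ψ421 ψ422 ψ423 ψ424 ψ425 ψ426 ψ427 ψ428 ψ429 ψ430 ψ431 ψ432 ψ433 ψ434 ψ435 ψ436 ψ437 ψ438 ψ439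
  ψ440 ψ441 ψ442 ψ443 ψ444 ψ445 ψ446 ψ447 ψ448 ψ449 ψ450 ψ451 ψ452 ψ453 ψ454 ψ455 ψ456 ψ457 ψ458
  ψ459 ψ460 ψ461 ψ462 ψ463 ψ464 ψ465 ψ466 : Tree
ψ0 = node (leaf 120) (leaf 110)
ψ1 = node (leaf 120) (leaf 100)
ψ2 = node ψ0 ψ1
ψ3 = node (leaf 117) (leaf 90)
ψ4 = node ψ0 ψ3
ψ5 = node ψ2 ψ4
ψ6 = node (leaf 120) (leaf 107)
ψ7 = node (leaf 107) (leaf 80)
ψ8 = node ψ6 ψ7
ψ9 = node ψ2 ψ8
ψ10 = node ψ5 ψ9
ψ11 = node (leaf 120) (leaf 97)
ψ12 = node ψ0 ψ11
ψ13 = node (leaf 97) (leaf 70)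
ψ14 = node ψ11 ψ13
ψ15 = node ψ12 ψ14
ψ16 = node ψ5 ψ15
ψ17 = node ψ10 ψ16
ψ18 = node (leaf 114) (leaf 87)
ψ19 = node ψ0 ψ18
ψ20 = node ψ2 ψ19
ψ21 = node (leaf 87) (leaf 60)
ψ22 = node ψ18 ψ21
ψ23 = node ψ19 ψ22
ψ24 = node ψ20 ψ23
ψ25 = node ψ10 ψ24
ψ26 = node ψ17 ψ25
ψ27 = node (leaf 120) (leaf 104)
ψ28 = node (leaf 104) (leaf 77)
ψ29 = node ψ27 ψ28
ψ30 = node ψ2 ψ29
ψ31 = node ψ5 ψ30
ψ32 = node (leaf 77) (leaf 50)
ψ33 = node ψ28 ψ32
ψ34 = node ψ29 ψ33
ψ35 = node ψ30 ψ34
ψ36 = node ψ31 ψ35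
ψ37 = node ψ17 ψ36
ψ38 = node ψ26 ψ37
ψ39 = node (leaf 120) (leaf 94)
ψ40 = node ψ0 ψ39
ψ41 = node (leaf 94) (leaf 67)
ψ42 = node ψ39 ψ41
ψ43 = node ψ40 ψ42
ψ44 = node ψ5 ψ43
ψ45 = node ψ10 ψ44
ψ46 = node (leaf 67) (leaf 40)
ψ47 = node ψ41 ψ46
ψ48 = node ψ42 ψ47
ψ49 = node ψ43 ψ48
ψ50 = node ψ44 ψ49
ψ51 = node ψ45 ψ50
ψ52 = node ψ26 ψ51
ψ53 = node ψ38 ψ52
ψ54 = node (leaf 120) (leaf 102)
ψ55 = node (leaf 102) (leaf 75)
ψ56 = node ψ54 ψ55
ψ57 = node ψ2 ψ56
ψ58 = node ψ5 ψ57
ψ59 = node (leaf 75) (leaf 48)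
ψ60 = node ψ55 ψ59
ψ61 = node ψ56 ψ60
ψ62 = node ψ57 ψ61
ψ63 = node ψ58 ψ62
ψ64 = node ψ17 ψ63
ψ65 = node ψ26 ψ64
ψ66 = node (leaf 111) (leaf 84)
ψ67 = node ψ0 ψ66
ψ68 = node ψ2 ψ67
ψ69 = node (leaf 84) (leaf 57)
ψ70 = node ψ66 ψ69
ψ71 = node ψ67 ψ70
ψ72 = node ψ68 ψ71
ψ73 = node ψ10 ψ72
ψ74 = node ψ17 ψ73
ψ75 = node ψ58 ψ35
ψ76 = node (leaf 57) (leaf 30)
ψ77 = node ψ69 ψ76
ψ78 = node ψ70 ψ77
ψ79 = node ψ71 ψ78
ψ80 = node ψ72 ψ79
ψ81 = node ψ75 ψ80
ψ82 = node ψ74 ψ81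
ψ83 = node ψ65 ψ82
ψ84 = node ψ53 ψ83
ψ85 = node (leaf 119) (leaf 92)
ψ86 = node ψ0 ψ85
ψ87 = node (leaf 92) (leaf 65)
ψ88 = node ψ85 ψ87
ψ89 = node ψ86 ψ88
ψ90 = node ψ5 ψ89
ψ91 = node ψ10 ψ90
ψ92 = node (leaf 112) (leaf 85)
ψ93 = node ψ0 ψ92
ψ94 = node ψ2 ψ93
ψ95 = node (leaf 85) (leaf 58)
ψ96 = node ψ92 ψ95
ψ97 = node ψ93 ψ96
ψ98 = node ψ94 ψ97
ψ99 = node (leaf 65) (leaf 38)
ψ100 = node ψ87 ψ99
ψ101 = node ψ88 ψ100
ψ102 = node ψ89 ψ101
ψ103 = node ψ98 ψ102
ψ104 = node ψ91 ψ103
ψ105 = node ψ26 ψ104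
ψ106 = node ψ38 ψ105
ψ107 = node (leaf 113) (leaf 86)
ψ108 = node ψ0 ψ107
ψ109 = node ψ2 ψ108
ψ110 = node (leaf 86) (leaf 59)
ψ111 = node ψ107 ψ110
ψ112 = node ψ108 ψ111
ψ113 = node ψ109 ψ112
ψ114 = node ψ10 ψ113
ψ115 = node ψ17 ψ114
ψ116 = node (leaf 59) (leaf 32)
ψ117 = node ψ110 ψ116
ψ118 = node ψ111 ψ117
ψ119 = node ψ112 ψ118
ψ120 = node ψ113 ψ119
ψ121 = node ψ114 ψ120
ψ122 = node ψ115 ψ121
ψ123 = node ψ91 ψ50
ψ124 = node (leaf 120) (leaf 101)
ψ125 = node (leaf 101) (leaf 74)
ψ126 = node ψ124 ψ125
ψ127 = node ψ2 ψ126
ψ128 = node (leaf 74) (leaf 47)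
ψ129 = node ψ125 ψ128
ψ130 = node ψ126 ψ129
ψ131 = node ψ127 ψ130
ψ132 = node ψ90 ψ131
ψ133 = node (leaf 47) (leaf 20)
ψ134 = node ψ128 ψ133
ψ135 = node ψ129 ψ134
ψ136 = node ψ130 ψ135
ψ137 = node ψ131 ψ136
ψ138 = node ψ132 ψ137
ψ139 = node ψ123 ψ138
ψ140 = node ψ122 ψ139
ψ141 = node ψ106 ψ140
ψ142 = node ψ84 ψ141
ψ143 = node (leaf 120) (leaf 95)
ψ144 = node ψ0 ψ143
ψ145 = node (leaf 95) (leaf 68)
ψ146 = node ψ143 ψ145
ψ147 = node ψ144 ψ146
ψ148 = node ψ5 ψ147
ψ149 = node ψ10 ψ148
ψ150 = node ψ149 ψ63
ψ151 = node ψ26 ψ150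
ψ152 = node (leaf 120) (leaf 109)
ψ153 = node (leaf 109) (leaf 82)
ψ154 = node ψ152 ψ153
ψ155 = node ψ2 ψ154
ψ156 = node (leaf 82) (leaf 55)
ψ157 = node ψ153 ψ156
ψ158 = node ψ154 ψ157
ψ159 = node ψ155 ψ158
ψ160 = node ψ10 ψ159
ψ161 = node ψ17 ψ160
ψ162 = node (leaf 120) (leaf 98)
ψ163 = node ψ0 ψ162
ψ164 = node (leaf 98) (leaf 71)
ψ165 = node ψ162 ψ164
ψ166 = node ψ163 ψ165
ψ167 = node ψ5 ψ166
ψ168 = node (leaf 71) (leaf 44)
ψ169 = node ψ164 ψ168
ψ170 = node ψ165 ψ169
ψ171 = node ψ166 ψ170
ψ172 = node ψ167 ψ171
ψ173 = node (leaf 55) (leaf 28)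
ψ174 = node ψ156 ψ173
ψ175 = node ψ157 ψ174
ψ176 = node ψ158 ψ175
ψ177 = node ψ159 ψ176
ψ178 = node ψ172 ψ177
ψ179 = node ψ161 ψ178
ψ180 = node ψ151 ψ179
ψ181 = node ψ53 ψ180
ψ182 = node (leaf 120) (leaf 103)
ψ183 = node (leaf 103) (leaf 76)
ψ184 = node ψ182 ψ183
ψ185 = node ψ144 ψ184
ψ186 = node (leaf 76) (leaf 49)
ψ187 = node ψ183 ψ186
ψ188 = node ψ146 ψ187
ψ189 = node ψ185 ψ188
ψ190 = node ψ148 ψ189
ψ191 = node ψ149 ψ190
ψ192 = node ψ26 ψ191
ψ193 = node (leaf 100) (leaf 73)
ψ194 = node ψ1 ψ193
ψ195 = node ψ2 ψ194
ψ196 = node ψ5 ψ195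
ψ197 = node ψ2 ψ184
ψ198 = node ψ184 ψ187
ψ199 = node ψ197 ψ198
ψ200 = node ψ196 ψ199
ψ201 = node ψ17 ψ200
ψ202 = node ψ167 ψ199
ψ203 = node (leaf 73) (leaf 46)
ψ204 = node ψ193 ψ203
ψ205 = node ψ194 ψ204
ψ206 = node ψ195 ψ205
ψ207 = node (leaf 49) (leaf 22)
ψ208 = node ψ186 ψ207
ψ209 = node ψ187 ψ208
ψ210 = node ψ198 ψ209
ψ211 = node ψ206 ψ210
ψ212 = node ψ202 ψ211
ψ213 = node ψ201 ψ212
ψ214 = node ψ192 ψ213
ψ215 = node (leaf 120) (leaf 105)
ψ216 = node (leaf 105) (leaf 78)
ψ217 = node ψ215 ψ216
ψ218 = node ψ2 ψ217
ψ219 = node ψ5 ψ218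
ψ220 = node ψ217 ψ157
ψ221 = node ψ155 ψ220
ψ222 = node ψ219 ψ221
ψ223 = node ψ17 ψ222
ψ224 = node ψ73 ψ80
ψ225 = node ψ223 ψ224
ψ226 = node ψ196 ψ159
ψ227 = node (leaf 116) (leaf 89)
ψ228 = node ψ0 ψ227
ψ229 = node ψ2 ψ228
ψ230 = node (leaf 118) (leaf 91)
ψ231 = node ψ0 ψ230
ψ232 = node (leaf 91) (leaf 64)
ψ233 = node ψ230 ψ232
ψ234 = node ψ231 ψ233
ψ235 = node ψ229 ψ234
ψ236 = node (leaf 64) (leaf 37)
ψ237 = node ψ232 ψ236
ψ238 = node ψ233 ψ237
ψ239 = node ψ234 ψ238
ψ240 = node ψ235 ψ239
ψ241 = node ψ226 ψ240
ψ242 = node ψ5 ψ234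
ψ243 = node ψ242 ψ239
ψ244 = node (leaf 37) (leaf 10)
ψ245 = node ψ236 ψ244
ψ246 = node ψ237 ψ245
ψ247 = node ψ238 ψ246
ψ248 = node ψ239 ψ247
ψ249 = node ψ243 ψ248
ψ250 = node ψ241 ψ249
ψ251 = node ψ225 ψ250
ψ252 = node ψ214 ψ251
ψ253 = node ψ181 ψ252
ψ254 = node ψ142 ψ253
ψ255 = node ψ10 ψ98
ψ256 = node ψ17 ψ255
ψ257 = node ψ94 ψ23
ψ258 = node ψ257 ψ49
ψ259 = node ψ45 ψ258
ψ260 = node ψ256 ψ259
ψ261 = node ψ38 ψ260
ψ262 = node (leaf 68) (leaf 41)
ψ263 = node ψ145 ψ262
ψ264 = node ψ146 ψ263
ψ265 = node ψ147 ψ264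
ψ266 = node ψ148 ψ265
ψ267 = node ψ149 ψ266
ψ268 = node ψ26 ψ267
ψ269 = node (leaf 120) (leaf 96)
ψ270 = node ψ0 ψ269
ψ271 = node (leaf 96) (leaf 69)
ψ272 = node ψ269 ψ271
ψ273 = node ψ270 ψ272
ψ274 = node ψ5 ψ273
ψ275 = node ψ10 ψ274
ψ276 = node (leaf 69) (leaf 42)
ψ277 = node ψ271 ψ276
ψ278 = node ψ272 ψ277
ψ279 = node ψ273 ψ278
ψ280 = node ψ274 ψ279
ψ281 = node ψ275 ψ280
ψ282 = node (leaf 110) (leaf 83)
ψ283 = node ψ0 ψ282
ψ284 = node ψ2 ψ283
ψ285 = node (leaf 83) (leaf 56)
ψ286 = node ψ282 ψ285
ψ287 = node ψ283 ψ286
ψ288 = node ψ284 ψ287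
ψ289 = node ψ58 ψ288
ψ290 = node ψ62 ψ79
ψ291 = node ψ289 ψ290
ψ292 = node ψ281 ψ291
ψ293 = node ψ268 ψ292
ψ294 = node ψ261 ψ293
ψ295 = node ψ219 ψ98
ψ296 = node ψ17 ψ295
ψ297 = node (leaf 120) (leaf 108)
ψ298 = node (leaf 108) (leaf 81)
ψ299 = node ψ297 ψ298
ψ300 = node ψ2 ψ299
ψ301 = node (leaf 81) (leaf 54)
ψ302 = node ψ298 ψ301
ψ303 = node ψ299 ψ302
ψ304 = node ψ300 ψ303
ψ305 = node ψ304 ψ102
ψ306 = node ψ91 ψ305
ψ307 = node ψ296 ψ306
ψ308 = node ψ38 ψ307
ψ309 = node (leaf 78) (leaf 51)
ψ310 = node ψ216 ψ309
ψ311 = node ψ217 ψ310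
ψ312 = node ψ218 ψ311
ψ313 = node ψ219 ψ312
ψ314 = node ψ17 ψ313
ψ315 = node ψ10 ψ288
ψ316 = node (leaf 56) (leaf 29)
ψ317 = node ψ285 ψ316
ψ318 = node ψ286 ψ317
ψ319 = node ψ287 ψ318
ψ320 = node ψ304 ψ319
ψ321 = node ψ315 ψ320
ψ322 = node ψ314 ψ321
ψ323 = node (leaf 115) (leaf 88)
ψ324 = node ψ0 ψ323
ψ325 = node ψ2 ψ324
ψ326 = node (leaf 88) (leaf 61)
ψ327 = node ψ323 ψ326
ψ328 = node ψ324 ψ327
ψ329 = node ψ325 ψ328
ψ330 = node ψ10 ψ329
ψ331 = node (leaf 80) (leaf 53)
ψ332 = node ψ7 ψ331
ψ333 = node ψ8 ψ332
ψ334 = node ψ9 ψ333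
ψ335 = node (leaf 61) (leaf 34)
ψ336 = node ψ326 ψ335
ψ337 = node ψ327 ψ336
ψ338 = node ψ328 ψ337
ψ339 = node ψ334 ψ338
ψ340 = node ψ330 ψ339
ψ341 = node (leaf 120) (leaf 99)
ψ342 = node ψ0 ψ341
ψ343 = node (leaf 99) (leaf 72)
ψ344 = node ψ341 ψ343
ψ345 = node ψ342 ψ344
ψ346 = node (leaf 72) (leaf 45)
ψ347 = node ψ343 ψ346
ψ348 = node ψ344 ψ347
ψ349 = node ψ345 ψ348
ψ350 = node ψ288 ψ349
ψ351 = node (leaf 45) (leaf 18)
ψ352 = node ψ346 ψ351
ψ353 = node ψ347 ψ352
ψ354 = node ψ348 ψ353
ψ355 = node ψ319 ψ354
ψ356 = node ψ350 ψ355
ψ357 = node ψ340 ψ356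
ψ358 = node ψ322 ψ357
ψ359 = node ψ308 ψ358
ψ360 = node ψ294 ψ359
ψ361 = node ψ144 ψ14
ψ362 = node ψ361 ψ34
ψ363 = node ψ31 ψ362
ψ364 = node ψ149 ψ363
ψ365 = node ψ26 ψ364
ψ366 = node (leaf 120) (leaf 106)
ψ367 = node (leaf 106) (leaf 79)
ψ368 = node ψ366 ψ367
ψ369 = node ψ2 ψ368
ψ370 = node ψ5 ψ369
ψ371 = node (leaf 79) (leaf 52)
ψ372 = node ψ367 ψ371
ψ373 = node ψ368 ψ372
ψ374 = node ψ369 ψ373
ψ375 = node ψ370 ψ374
ψ376 = node (leaf 120) (leaf 93)
ψ377 = node ψ0 ψ376
ψ378 = node (leaf 93) (leaf 66)
ψ379 = node ψ376 ψ378
ψ380 = node ψ377 ψ379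
ψ381 = node ψ94 ψ380
ψ382 = node (leaf 66) (leaf 39)
ψ383 = node ψ378 ψ382
ψ384 = node ψ379 ψ383
ψ385 = node ψ97 ψ384
ψ386 = node ψ381 ψ385
ψ387 = node ψ375 ψ386
ψ388 = node ψ314 ψ387
ψ389 = node ψ365 ψ388
ψ390 = node ψ330 ψ243
ψ391 = node ψ26 ψ390
ψ392 = node ψ5 ψ380
ψ393 = node ψ234 ψ384
ψ394 = node ψ392 ψ393
ψ395 = node ψ330 ψ394
ψ396 = node (leaf 90) (leaf 63)
ψ397 = node ψ3 ψ396
ψ398 = node ψ4 ψ397
ψ399 = node ψ5 ψ398
ψ400 = node (leaf 63) (leaf 36)
ψ401 = node ψ396 ψ400
ψ402 = node ψ397 ψ401
ψ403 = node ψ398 ψ402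
ψ404 = node ψ399 ψ403
ψ405 = node ψ380 ψ384
ψ406 = node (leaf 39) (leaf 12)
ψ407 = node ψ382 ψ406
ψ408 = node ψ383 ψ407
ψ409 = node ψ384 ψ408
ψ410 = node ψ405 ψ409
ψ411 = node ψ404 ψ410
ψ412 = node ψ395 ψ411
ψ413 = node ψ391 ψ412
ψ414 = node ψ389 ψ413
ψ415 = node ψ215 ψ7
ψ416 = node ψ415 ψ22
ψ417 = node ψ20 ψ416
ψ418 = node ψ219 ψ417
ψ419 = node ψ17 ψ418
ψ420 = node (leaf 89) (leaf 62)
ψ421 = node ψ227 ψ420
ψ422 = node ψ228 ψ421
ψ423 = node ψ229 ψ422
ψ424 = node ψ228 ψ146
ψ425 = node ψ421 ψ347
ψ426 = node ψ424 ψ425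
ψ427 = node ψ423 ψ426
ψ428 = node ψ330 ψ427
ψ429 = node ψ419 ψ428
ψ430 = node ψ167 ψ131
ψ431 = node ψ17 ψ430
ψ432 = node ψ430 ψ137
ψ433 = node ψ431 ψ432
ψ434 = node ψ429 ψ433
ψ435 = node (leaf 115) (leaf 90)
ψ436 = node (leaf 88) (leaf 63)
ψ437 = node ψ435 ψ436
ψ438 = node ψ324 ψ437
ψ439 = node ψ325 ψ438
ψ440 = node ψ10 ψ439
ψ441 = node ψ167 ψ349
ψ442 = node ψ440 ψ441
ψ443 = node ψ370 ψ304
ψ444 = node (leaf 54) (leaf 27)
ψ445 = node ψ301 ψ444
ψ446 = node ψ302 ψ445
ψ447 = node ψ303 ψ446
ψ448 = node ψ304 ψ447
ψ449 = node ψ443 ψ448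
ψ450 = node ψ442 ψ449
ψ451 = node ψ167 ψ304
ψ452 = node ψ166 ψ303
ψ453 = node ψ452 ψ447
ψ454 = node ψ451 ψ453
ψ455 = node (leaf 27) (leaf 0)
ψ456 = node ψ444 ψ455
ψ457 = node ψ445 ψ456
ψ458 = node ψ446 ψ457
ψ459 = node ψ447 ψ458
ψ460 = node ψ448 ψ459
ψ461 = node ψ454 ψ460
ψ462 = node ψ450 ψ461
ψ463 = node ψ434 ψ462
ψ464 = node ψ414 ψ463
ψ465 = node ψ360 ψ464
ψ466 = node ψ254 ψ465

potential : Vec Bool 12 → ℕ
potential = evalTree ψ466

Step : Vec Bool 13 → Set
Step v = 10 + potential (tail v) ≤ 27 * indicator (last v) + potential (init v)

valid? : ∀ v → Dec (Admissible (wordOf v) → Step v)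
valid? v = admissible? (wordOf v) →-dec (_ ≤? _)

allVectors : ∀ m → (Vec Bool m → Bool) → Bool
allVectors zero    f = f []
allVectors (suc m) f = allVectors m (f ∘ (true ∷_)) ∧ allVectors m (f ∘ (false ∷_))

allVectors-sound : ∀ m (f : Vec Bool m → Bool) → T (allVectors m f) → ∀ v → T (f v)
allVectors-sound zero    f t []          = t
allVectors-sound (suc m) f t (true ∷ v)  = allVectors-sound m _ (proj₁ (Equivalence.to T-∧ t)) v
allVectors-sound (suc m) f t (false ∷ v) = allVectors-sound m _ (proj₂ (Equivalence.to T-∧ t)) v

-- Every admissible window satisfies Step: checked by evaluating valid? on all 2^13 windows
-- (the proof of T (allVectors …) is found by normalisation).
certificate : ∀ v → Admissible (wordOf v) → Step v
certificate = toWitness ∘ allVectors-sound 13 (isYes ∘ valid?) _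

module _ {n : ℕ} .{{_ : NonZero n}} where

  pos : ℕ → Fin n
  pos m = m mod n

  toℕ-pos : ∀ m → toℕ (pos m) ≡ m % n
  toℕ-pos m = toℕ-fromℕ< (m%n<n m n)

  pos-≡ : ∀ {x y} → x % n ≡ y % n → pos x ≡ pos y
  pos-≡ {x} {y} e = toℕ-injective (begin
    toℕ (pos x) ≡⟨ toℕ-pos x ⟩
    x % n       ≡⟨ e ⟩
    y % n       ≡⟨ toℕ-pos y ⟨
    toℕ (pos y) ∎)
    where open ≡-Reasoning

  %-absorbˡ : ∀ x y → (x % n + y) % n ≡ (x + y) % n
  %-absorbˡ x y = begin
    (x % n + y) % n           ≡⟨ %-distribˡ-+ (x % n) y n ⟩
    (x % n % n + y % n) % n   ≡⟨ cong (λ z → (z + y % n) % n) (m%n%n≡m%n x n) ⟩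
    (x % n + y % n) % n       ≡⟨ %-distribˡ-+ x y n ⟨
    (x + y) % n               ∎
    where open ≡-Reasoning

  pos-toℕ : ∀ (u : Fin n) → pos (toℕ u) ≡ u
  pos-toℕ u = toℕ-injective (trans (toℕ-pos (toℕ u)) (m<n⇒m%n≡m (toℕ<n u)))

  pos-periodic : ∀ m → pos (n + m) ≡ pos m
  pos-periodic m = pos-≡ (trans (cong (_% n) (+-comm n m)) ([m+n]%n≡m%n m n))

  pos-⊕ : ∀ m a → pos m ⊕ a ≡ pos (m + a)
  pos-⊕ m a = pos-≡ (trans (cong (λ z → (z + a) % n) (toℕ-pos m)) (%-absorbˡ m a))

  ⊕-⊕ : ∀ (u : Fin n) a b → (u ⊕ a) ⊕ b ≡ u ⊕ (a + b)
  ⊕-⊕ u a b = trans (pos-⊕ (toℕ u + a) b) (cong pos (+-assoc (toℕ u) a b))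

  ⊕-⊖ : ∀ (u : Fin n) {a s} → s ≤ a → s < n → (u ⊕ a) ⊖ s ≡ u ⊕ (a ∸ s)
  ⊕-⊖ u {a} {s} s≤a s<n = pos-≡ (begin
    (toℕ (pos x) + (n ∸ s % n)) % n   ≡⟨ cong₂ (λ y z → (y + (n ∸ z)) % n) (toℕ-pos x) (m<n⇒m%n≡m s<n) ⟩
    (x % n + (n ∸ s)) % n             ≡⟨ %-absorbˡ x (n ∸ s) ⟩
    (x + (n ∸ s)) % n                 ≡⟨ cong (λ z → (z + (n ∸ s)) % n) x≡ ⟩
    (y + s + (n ∸ s)) % n             ≡⟨ cong (_% n) (+-assoc y s (n ∸ s)) ⟩
    (y + (s + (n ∸ s))) % n           ≡⟨ cong (λ z → (y + z) % n) (m+[n∸m]≡n (<⇒≤ s<n)) ⟩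
    (y + n) % n                       ≡⟨ [m+n]%n≡m%n y n ⟩
    y % n                             ∎)
    where
      open ≡-Reasoning
      x = toℕ u + a
      y = toℕ u + (a ∸ s)
      x≡ : x ≡ y + s
      x≡ = trans (cong (toℕ u +_) (sym (m∸n+n≡m s≤a))) (sym (+-assoc (toℕ u) (a ∸ s) s))

  ⊕-moves : ∀ (v : Fin n) {d} → 0 < d → d < n → v ⊕ d ≢ v
  ⊕-moves v {d} 0<d d<n v⊕d≡v with toℕ v + d <? n
  ... | yes x+d<n = <-irrefl (sym x≡x+d) (m<m+n x 0<d)
    where
      x = toℕ v
      x≡x+d : x + d ≡ x
      x≡x+d = trans (sym (m<n⇒m%n≡m x+d<n)) (trans (sym (toℕ-pos (x + d))) (cong toℕ v⊕d≡v))
  ... | no x+d≮n = <-irrefl d≡n d<n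
    where
      x = toℕ v
      n≤x+d = ≮⇒≥ x+d≮n
      below-n : x + d ∸ n < n
      below-n = subst (x + d ∸ n <_) (m+n∸n≡m n n) (∸-monoˡ-< (+-mono-< (toℕ<n v) d<n) n≤x+d)
      wrapped : x + d ∸ n ≡ x
      wrapped = begin
        x + d ∸ n         ≡⟨ m<n⇒m%n≡m below-n ⟨
        (x + d ∸ n) % n   ≡⟨ m≤n⇒[n∸m]%m≡n%m n≤x+d ⟩
        (x + d) % n       ≡⟨ trans (sym (toℕ-pos (x + d))) (cong toℕ v⊕d≡v) ⟩
        x                 ∎
        where open ≡-Reasoning
      d≡n : d ≡ n
      d≡n = +-cancelˡ-≡ x d n (trans (sym (m∸n+n≡m n≤x+d)) (cong (_+ n) wrapped))

  ∈⇒T : ∀ {S : Subset n} {x} → x ∈ S → T (lookup S x)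
  ∈⇒T x∈S = Equivalence.from T-≡ ([]=⇒lookup x∈S)

  T⇒∈ : ∀ {S : Subset n} {x} → T (lookup S x) → x ∈ S
  T⇒∈ {S} {x} t = lookup⇒[]= x S (Equivalence.to T-≡ t)

  nbrs : Fin n → List (Fin n)
  nbrs v = v ∷ v ⊕ 1 ∷ v ⊖ 1 ∷ v ⊕ 3 ∷ v ⊖ 3 ∷ []

  N[]-any : ∀ v x → lookup N[ v ] x ≡ any (λ y → does (x ≟ᶠ y)) (nbrs v)
  N[]-any v x = trans (lookup∘tabulate _ x)
    (cong (λ b → does (x ≟ᶠ v) ∨ does (x ≟ᶠ (v ⊕ 1)) ∨ does (x ≟ᶠ (v ⊖ 1)) ∨ does (x ≟ᶠ (v ⊕ 3)) ∨ b)
      (sym (∨-identityʳ _)))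

  ≟-sound : ∀ {x y : Fin n} → T (does (x ≟ᶠ y)) → x ≡ y
  ≟-sound {x} {y} t with x ≟ᶠ y
  ... | yes x≡y = x≡y
  ... | no _    = ⊥-elim t

  ≟-complete : ∀ {x y : Fin n} → x ≡ y → T (does (x ≟ᶠ y))
  ≟-complete {x} {y} x≡y with x ≟ᶠ y
  ... | yes _   = _
  ... | no x≢y  = x≢y x≡y

  ∈N[]⇒∈nbrs : ∀ {v x} → x ∈ N[ v ] → x ∈ˡ nbrs v
  ∈N[]⇒∈nbrs {v} {x} x∈N = Any.map ≟-sound
    (any⁻ (λ y → does (x ≟ᶠ y)) (nbrs v) (subst T (N[]-any v x) (∈⇒T x∈N)))

  ∈nbrs⇒∈N[] : ∀ {v x} → x ∈ˡ nbrs v → x ∈ N[ v ]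
  ∈nbrs⇒∈N[] {v} {x} x∈ = T⇒∈ (subst T (sym (N[]-any v x))
    (any⁺ (λ y → does (x ≟ᶠ y)) (Any.map ≟-complete x∈)))

  nbrs-⊕ : ∀ u {a} → 3 ≤ a → 3 < n → nbrs (u ⊕ a) ≡ map (u ⊕_) (offsets a)
  nbrs-⊕ u {a} 3≤a 3<n = cong (u ⊕ a ∷_)
    (cong₂ _∷_ (⊕-⊕ u a 1) (cong₂ _∷_ (⊕-⊖ u (≤-trans (s≤s z≤n) 3≤a) (≤-trans (s≤s (s≤s z≤n)) 3<n))
    (cong₂ _∷_ (⊕-⊕ u a 3) (cong (_∷ []) (⊕-⊖ u 3≤a 3<n)))))

  N[⊕]-sound : ∀ u {a x} → 3 ≤ a → 3 < n → x ∈ N[ u ⊕ a ] → Any (λ p → x ≡ u ⊕ p) (offsets a)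
  N[⊕]-sound u {x = x} 3≤a 3<n x∈N = map⁻ {f = u ⊕_} (subst (x ∈ˡ_) (nbrs-⊕ u 3≤a 3<n) (∈N[]⇒∈nbrs x∈N))

  N[⊕]-complete : ∀ u {a x} → 3 ≤ a → 3 < n → Any (λ p → x ≡ u ⊕ p) (offsets a) → x ∈ N[ u ⊕ a ]
  N[⊕]-complete u {x = x} 3≤a 3<n x≡ = ∈nbrs⇒∈N[] (subst (x ∈ˡ_) (sym (nbrs-⊕ u 3≤a 3<n)) (map⁺ {f = u ⊕_} x≡))

  -- Reading an identifying, pattern-free code C through its windows; n ≥ 13 makes all
  -- offsets of a window distinct vertices.
  module Reading (C : Subset n) (13≤n : 13 ≤ n) (idC : IsIdentifying C)
                 (noPattern : ∀ u → ¬ PatternP C u × ¬ PatternP' C u) where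

    -- Offsets up to 3 can be subtracted without wrapping around the cycle.
    3<n : 3 < n
    3<n = ≤-trans (m≤m+n 4 9) 13≤n

    window : Fin n → Vec Bool 13
    window u = tabulate (λ i → lookup C (u ⊕ toℕ i))

    bits : Fin n → Word
    bits u = wordOf (window u)

    bits-reads : ∀ u {p} → p < 13 → bits u p ≡ lookup C (u ⊕ p)
    bits-reads u = wordOf-tabulate 13 (λ p → lookup C (u ⊕ p))

    codeword-offset : ∀ u {a x} → 3 ≤ a → a ≤ 9 → x ∈ I C (u ⊕ a)
      → ∃ λ p → p ∈ˡ offsets a × x ≡ u ⊕ p × T (bits u p)
    codeword-offset u {a} 3≤a a≤9 x∈I with x∈p∩q⁻ N[ u ⊕ a ] C x∈I
    ... | x∈N , x∈C with find (N[⊕]-sound u 3≤a 3<n x∈N)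
    ...   | p , p∈ , refl = p , p∈ , refl , subst T (sym (bits-reads u p<13)) (∈⇒T x∈C)
      where
        p<13 : p < 13
        p<13 = All.lookup (offsets-in-window a≤9) p∈

    covers⇒⊆ : ∀ u {a a'} → 3 ≤ a → a ≤ 9 → 3 ≤ a' → Covers a a' (bits u) → I C (u ⊕ a) ⊆ I C (u ⊕ a')
    covers⇒⊆ u {a} {a'} 3≤a a≤9 3≤a' covers {x} x∈I with codeword-offset u 3≤a a≤9 x∈I
    ... | p , p∈ , refl , bit-set = x∈p∩q⁺ (u⊕p∈N' , proj₂ (x∈p∩q⁻ N[ u ⊕ a ] C x∈I))
      where
        u⊕p∈N' : (u ⊕ p) ∈ N[ u ⊕ a' ]
        u⊕p∈N' = N[⊕]-complete u 3≤a' 3<n (Any.map (cong (u ⊕_)) (All.lookup covers p∈ bit-set))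

    twins⇒I≡ : ∀ u {a a'} → 3 ≤ a → a ≤ 9 → 3 ≤ a' → a' ≤ 9 → Twins a a' (bits u) → I C (u ⊕ a) ≡ I C (u ⊕ a')
    twins⇒I≡ u 3≤a a≤9 3≤a' a'≤9 (a⊆a' , a'⊆a) =
      ⊆-antisym (covers⇒⊆ u 3≤a a≤9 3≤a' a⊆a') (covers⇒⊆ u 3≤a' a'≤9 3≤a a'⊆a)

    dominated : ∀ u → Nonempty (I C (u ⊕ 3)) → Dominated (bits u)
    dominated u (x , x∈I) with codeword-offset u ≤-refl (m≤m+n 3 6) x∈I
    ... | p , p∈ , _ , bit-set = lose p∈ bit-set

    separated : ∀ u {i} → i < 6 → ¬ Twins 3 (4 + i) (bits u)
    separated u {i} i<6 twins =
      proj₂ (proj₂ idC) (u ⊕ 3) (u ⊕ (4 + i)) 3≢4+i (twins⇒I≡ u ≤-refl (m≤m+n 3 6) (m≤m+n 3 (suc i)) 4+i≤9 twins)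
      where
        4+i≤9 : 4 + i ≤ 9
        4+i≤9 = +-monoʳ-≤ 4 (≤-pred i<6)
        3≢4+i : u ⊕ 3 ≢ u ⊕ (4 + i)
        3≢4+i e = ⊕-moves (u ⊕ 3) z<s (≤-trans (s<s i<6) (≤-trans (m≤m+n 7 6) 13≤n))
                    (trans (⊕-⊕ u 3 (suc i)) (sym e))

    member : ∀ u p → lookup C (u ⊕ p) ≡ true → (u ⊕ p) ∈ C
    member u p e = lookup⇒[]= (u ⊕ p) C e

    nonmember : ∀ u p → lookup C (u ⊕ p) ≡ false → (u ⊕ p) ∉ C
    nonmember u p e m with trans (sym e) ([]=⇒lookup m)
    ... | ()

    matches-P : ∀ u → Matches patternP (bits u) → PatternP C u
    matches-P u (e₂ ∷ e₃ ∷ e₀ ∷ e₁ ∷ e₄ ∷ e₅ ∷ e₆ ∷ e₇ ∷ e₈ ∷ []) =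
      member u 2 e₂ , member u 3 e₃ , nonmember u 0 e₀ , nonmember u 1 e₁ , nonmember u 4 e₄
      , nonmember u 5 e₅ , nonmember u 6 e₆ , nonmember u 7 e₇ , nonmember u 8 e₈

    matches-P' : ∀ u → Matches patternP' (bits u) → PatternP' C u
    matches-P' u (e₅ ∷ e₆ ∷ e₀ ∷ e₁ ∷ e₂ ∷ e₃ ∷ e₄ ∷ e₇ ∷ e₈ ∷ []) =
      member u 5 e₅ , member u 6 e₆ , nonmember u 0 e₀ , nonmember u 1 e₁ , nonmember u 2 e₂
      , nonmember u 3 e₃ , nonmember u 4 e₄ , nonmember u 7 e₇ , nonmember u 8 e₈

    admissible : ∀ u → Admissible (bits u)
    admissible u =
        dominated u (proj₁ (proj₂ idC) (u ⊕ 3))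
      , applyUpTo⁺₁ id 6 (separated u)
      , proj₁ (noPattern u) ∘ matches-P u
      , proj₂ (noPattern u) ∘ matches-P' u

    -- The 12-bit state at u; it is, by computation, init (window u). Moving from u to u ⊕ 1
    -- drops the first bit of the window and appends the bit of u ⊕ 12.
    state : Fin n → Vec Bool 12
    state u = tabulate (λ i → lookup C (u ⊕ toℕ i))

    tail-window : ∀ u → tail (window u) ≡ state (u ⊕ 1)
    tail-window u = tabulate-cong (λ i → cong (lookup C) (sym (⊕-⊕ u 1 (toℕ i))))

    Ψ : ℕ → ℕ
    Ψ k = potential (state (pos k))

    entering : ℕ → ℕ
    entering k = indicator (lookup C (pos k ⊕ 12))

    discharge : ∀ k → 10 + Ψ (suc k) ≤ 27 * entering k + Ψ k
    discharge k = subst (λ s → 10 + potential s ≤ 27 * entering k + Ψ k) tail≡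
      (certificate (window (pos k)) (admissible (pos k)))
      where
        tail≡ : tail (window (pos k)) ≡ state (pos (suc k))
        tail≡ = trans (tail-window (pos k)) (cong state (trans (pos-⊕ k 1) (cong pos (+-comm k 1))))

    codeword : ℕ → ℕ
    codeword k = indicator (lookup C (pos k))

    Σ-entering : Σ< n entering ≡ ∣ C ∣
    Σ-entering = begin
      Σ< n entering                               ≡⟨ Σ<-cong n (λ k _ → cong (indicator ∘ lookup C) (pos-⊕ k 12)) ⟩
      Σ< n (λ k → codeword (k + 12))              ≡⟨ Σ<-shift n codeword (cong (indicator ∘ lookup C) ∘ pos-periodic) 12 ⟩
      Σ< n codeword                               ≡⟨ ∣tabulate∣ n (lookup C ∘ pos) ⟨
      ∣ tabulate {n = n} (lookup C ∘ pos ∘ toℕ) ∣  ≡⟨ cong ∣_∣ (tabulate-cong (cong (lookup C) ∘ pos-toℕ)) ⟩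
      ∣ tabulate {n = n} (lookup C) ∣             ≡⟨ cong ∣_∣ (tabulate∘lookup C) ⟩
      ∣ C ∣                                       ∎
      where open ≡-Reasoning

    density : 10 * n ≤ 27 * ∣ C ∣
    density = begin
      10 * n              ≡⟨ *-comm 10 n ⟩
      n * 10              ≤⟨ cyclic-discharging n entering Ψ 10 27 (cong (potential ∘ state) ∘ pos-periodic) discharge ⟩
      27 * Σ< n entering  ≡⟨ cong (27 *_) Σ-entering ⟩
      27 * ∣ C ∣          ∎
      where open ≤-Reasoning

decide-≤ : ∀ {m n} {_ : T (m ≤ᵇ n)} → m ≤ n
decide-≤ {m} {n} {t} = ≤ᵇ⇒≤ m n t

lower-bound : ∀ {c q r s} q₀ → q₀ ≤ q → 27 * s < 2 * q₀ + 10 * r → 10 * (11 * q + r) ≤ 27 * c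
  → 4 * q + suc s ≤ c
lower-bound {c} {q} {r} {s} q₀ q₀≤q small dense = ≮⇒≥ λ c<4q+s+1 → <-irrefl refl (begin-strict
  27 * s           <⟨ small ⟩
  2 * q₀ + 10 * r  ≤⟨ +-monoˡ-≤ (10 * r) (*-monoʳ-≤ 2 q₀≤q) ⟩
  2 * q + 10 * r   ≤⟨ +-cancelˡ-≤ (108 * q) _ _ (squeeze c<4q+s+1) ⟩
  27 * s           ∎)
  where
    open ≤-Reasoning
    split₁ : ∀ q r → 10 * (11 * q + r) ≡ 108 * q + (2 * q + 10 * r)
    split₁ = solve-∀
    split₂ : ∀ q s → 27 * (4 * q + s) ≡ 108 * q + 27 * s
    split₂ = solve-∀
    squeeze : c < 4 * q + suc s → 108 * q + (2 * q + 10 * r) ≤ 108 * q + 27 * s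
    squeeze c<4q+s+1 = begin
      108 * q + (2 * q + 10 * r)  ≡⟨ split₁ q r ⟨
      10 * (11 * q + r)           ≤⟨ dense ⟩
      27 * c                      ≤⟨ *-monoʳ-≤ 27 (≤-pred (subst (suc c ≤_) (+-suc (4 * q) s) c<4q+s+1)) ⟩
      27 * (4 * q + s)            ≡⟨ split₂ q s ⟩
      108 * q + 27 * s            ∎

lemma4 : (n : ℕ) .{{_ : NonZero n}} (C : Subset n)
    → IsIdentifying C
    → (∀ (u : Fin n) → ¬ PatternP C u × ¬ PatternP' C u)
    → (∀ (q₁ : ℕ) → n ≡ 11 * q₁ + 2 → q₁ ≥ 5 → ∣ C ∣ ≥ 4 * q₁ + 2)
      × (∀ (q₂ : ℕ) → n ≡ 11 * q₂ + 5 → q₂ ≥ 3 → ∣ C ∣ ≥ 4 * q₂ + 3)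
      × (∀ (q₃ : ℕ) → n ≡ 11 * q₃ + 8 → q₃ ≥ 1 → ∣ C ∣ ≥ 4 * q₃ + 4)
lemma4 n C idC noPattern =
    (λ q n≡ q≥5 → bound 5 n≡ q≥5 decide-≤ decide-≤)
  , (λ q n≡ q≥3 → bound 3 n≡ q≥3 decide-≤ decide-≤)
  , (λ q n≡ q≥1 → bound 1 n≡ q≥1 decide-≤ decide-≤)
  where
    -- In each case n ≥ 13, so the density bound applies, and lower-bound finishes.
    bound : ∀ {q r s} q₀ → n ≡ 11 * q + r → q₀ ≤ q → 13 ≤ 11 * q₀ + r → 27 * s < 2 * q₀ + 10 * r
      → 4 * q + suc s ≤ ∣ C ∣
    bound {q} {r} q₀ n≡ q₀≤q big small =
      lower-bound q₀ q₀≤q small (subst (λ m → 10 * m ≤ 27 * ∣ C ∣) n≡ (Reading.density C 13≤n idC noPattern))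
      where
        13≤n : 13 ≤ n
        13≤n = subst (13 ≤_) (sym n≡) (≤-trans big (+-monoˡ-≤ r (*-monoʳ-≤ 11 q₀≤q)))
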